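{- Let $a$ be a positive integer that is not a perfect cube. Then the Diophantine equation $(xz+1)(yz+1)=az^3+1$ has no solutions in positive integers $x,y,z$ with $z>a^2+2a$. -}

module Defs where

open import Data.Nat using (ℕ; _^_)
open import Data.Product using (∃)
open import Relation.Binary.PropositionalEquality using (_≡_)

IsPerfectCube : ℕ → Set
IsPerfectCube a = ∃ λ b → a ≡ b ^ 3

{-# OPTIONS --safe #-}
module Submission where

open import Defs
open import Data.List using (_∷_; [])
open import Data.Nat using (ℕ; zero; suc; _+_; _*_; _^_; _<_; _>_; _≤_; NonZero; >-nonZero; >-nonZero⁻¹; ≤-pred)
open import Data.Nat.Divisibility using (divides; ∣m+n∣m⇒∣n)
open import Data.Nat.Properties
open import Data.Nat.Tactic.RingSolver using (solve)
open import Data.Product using (∃; _×_; _,_)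
open import Data.Sum using (_⊎_; inj₁; inj₂; [_,_])
open import Relation.Binary using (tri<; tri≈; tri>)
open import Relation.Binary.PropositionalEquality using (_≡_; refl; sym; trans; cong; subst; module ≡-Reasoning)
open import Relation.Nullary using (¬_)

-- Expanding, x y z + x + y = a z², so z ∣ x + y; writing x + y = k z gives
-- k + x y = a z, and eliminating y leaves x² + a z = x k z + k.  Take x ≤ y
-- and compare x k with a.  If x k = a then k = x², so a = x³.  If x k < a
-- then z ≤ k < a.  If x k = a + e with e > 0, then x² = e z + k, and
-- x k z = x (x + y) ≤ 2 x y < 2 a z gives e < a; hence
-- e z < k² x² = (a + e)² ≤ e (a + 1)², so again z ≤ a² + 2a.

cube-equation⇒reduced : ∀ a x y z .{{_ : NonZero z}} →
  (x * z + 1) * (y * z + 1) ≡ a * z ^ 3 + 1 → x * y * z + (x + y) ≡ a * z * z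
cube-equation⇒reduced a x y z eq = *-cancelˡ-≡ _ _ z (+-cancelʳ-≡ 1 _ _ (begin
  z * (x * y * z + (x + y)) + 1 ≡⟨ solve (x ∷ y ∷ z ∷ []) ⟩
  (x * z + 1) * (y * z + 1)     ≡⟨ eq ⟩
  a * z ^ 3 + 1                 ≡⟨⟩
  a * (z * (z * (z * 1))) + 1   ≡⟨ solve (a ∷ z ∷ []) ⟩
  z * (a * z * z) + 1           ∎))
  where open ≡-Reasoning

reduced⇒product-equation : ∀ a x y z k .{{_ : NonZero z}} →
  x * y * z + (x + y) ≡ a * z * z → x + y ≡ k * z → k + x * y ≡ a * z
reduced⇒product-equation a x y z k eq x+y≡kz = *-cancelʳ-≡ _ _ z (begin
  (k + x * y) * z     ≡⟨ solve (k ∷ x ∷ y ∷ z ∷ []) ⟩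
  x * y * z + k * z   ≡⟨ cong (x * y * z +_) (sym x+y≡kz) ⟩
  x * y * z + (x + y) ≡⟨ eq ⟩
  a * z * z           ∎)
  where open ≡-Reasoning

reduced⇒system : ∀ a x y z .{{_ : NonZero z}} → x * y * z + (x + y) ≡ a * z * z →
  ∃ λ k → x + y ≡ k * z × k + x * y ≡ a * z
reduced⇒system a x y z eq with ∣m+n∣m⇒∣n (divides (a * z) eq) (divides (x * y) refl)
... | divides k x+y≡kz = k , x+y≡kz , reduced⇒product-equation a x y z k eq x+y≡kz

system⇒square-identity : ∀ a s b k z → s + b ≡ k * z → k + s * b ≡ a * z →
  s * s + z * a ≡ z * (s * k) + k
system⇒square-identity a s b k z s+b≡kz k+sb≡az = begin
  s * s + z * a       ≡⟨ cong (s * s +_) (trans (*-comm z a) (sym k+sb≡az)) ⟩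
  s * s + (k + s * b) ≡⟨ solve (s ∷ b ∷ k ∷ []) ⟩
  k + s * (s + b)     ≡⟨ cong (λ t → k + s * t) s+b≡kz ⟩
  k + s * (k * z)     ≡⟨ solve (s ∷ k ∷ z ∷ []) ⟩
  z * (s * k) + k     ∎
  where open ≡-Reasoning

system⇒sk<2a : ∀ a s b k z .{{_ : NonZero k}} → s ≤ b → s + b ≡ k * z → k + s * b ≡ a * z →
  s * k < a + a
system⇒sk<2a a s b k z s≤b s+b≡kz k+sb≡az = *-cancelˡ-< z _ _ (begin-strict
  z * (s * k)   ≡⟨ solve (z ∷ s ∷ k ∷ []) ⟩
  s * (k * z)   ≡⟨ cong (s *_) (sym s+b≡kz) ⟩
  s * (s + b)   ≡⟨ *-distribˡ-+ s s b ⟩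
  s * s + s * b ≤⟨ +-monoˡ-≤ (s * b) (*-monoʳ-≤ s s≤b) ⟩
  s * b + s * b <⟨ +-mono-< sb<az sb<az ⟩
  a * z + a * z ≡⟨ solve (a ∷ z ∷ []) ⟩
  z * (a + a)   ∎)
  where
    open ≤-Reasoning
    sb<az : s * b < a * z
    sb<az = ≤-trans (m<n+m (s * b) (>-nonZero⁻¹ k)) (≤-reflexive k+sb≡az)

square-identity-at-a⇒cube : ∀ a s k z → s * k ≡ a → s * s + z * a ≡ z * (s * k) + k →
  IsPerfectCube a
square-identity-at-a⇒cube a s k z sk≡a eq = s , (begin
  a           ≡⟨ sym sk≡a ⟩
  s * k       ≡⟨ cong (s *_) k≡s² ⟩
  s * (s * s) ≡⟨ solve (s ∷ []) ⟩
  s * (s * (s * 1)) ≡⟨⟩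
  s ^ 3       ∎)
  where
    open ≡-Reasoning
    k≡s² : k ≡ s * s
    k≡s² = sym (+-cancelˡ-≡ (z * a) _ _ (begin
      z * a + s * s   ≡⟨ +-comm (z * a) (s * s) ⟩
      s * s + z * a   ≡⟨ eq ⟩
      z * (s * k) + k ≡⟨ cong (λ t → z * t + k) sk≡a ⟩
      z * a + k       ∎))

square-identity-below-a⇒z≤k : ∀ a s k z → s * k < a → s * s + z * a ≡ z * (s * k) + k → z ≤ k
square-identity-below-a⇒z≤k a s k z sk<a eq = +-cancelˡ-≤ (z * (s * k)) _ _ (begin
  z * (s * k) + z ≡⟨ +-comm (z * (s * k)) z ⟩
  z + z * (s * k) ≡⟨ *-suc z (s * k) ⟨
  z * suc (s * k) ≤⟨ *-monoʳ-≤ z sk<a ⟩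
  z * a           ≤⟨ m≤n+m (z * a) (s * s) ⟩
  s * s + z * a   ≡⟨ eq ⟩
  z * (s * k) + k ∎)
  where open ≤-Reasoning

square-identity-above-a⇒ze<[a+e]² : ∀ a e s k z .{{_ : NonZero k}} → s * k ≡ a + e →
  s * s + z * a ≡ z * (s * k) + k → z * e < (a + e) * (a + e)
square-identity-above-a⇒ze<[a+e]² a e s k z sk≡a+e eq = begin-strict
  z * e                       ≤⟨ m≤n*m (z * e) (k * k) ⟩
  k * k * (z * e)             <⟨ m<m+n _ (>-nonZero⁻¹ (k * k * k)) ⟩
  k * k * (z * e) + k * k * k ≡⟨ solve (k ∷ z ∷ e ∷ []) ⟩
  k * k * (z * e + k)         ≡⟨ cong (k * k *_) s²≡ze+k ⟨
  k * k * (s * s)             ≡⟨ solve (k ∷ s ∷ []) ⟩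
  (s * k) * (s * k)           ≡⟨ cong (λ t → t * t) sk≡a+e ⟩
  (a + e) * (a + e)           ∎
  where
    open ≤-Reasoning
    instance
      k²≢0 : NonZero (k * k)
      k²≢0 = m*n≢0 k k
      k³≢0 : NonZero (k * k * k)
      k³≢0 = m*n≢0 (k * k) k
    s²≡ze+k : s * s ≡ z * e + k
    s²≡ze+k = +-cancelʳ-≡ (z * a) _ _ (begin-equality
      s * s + z * a     ≡⟨ eq ⟩
      z * (s * k) + k   ≡⟨ cong (λ t → z * t + k) sk≡a+e ⟩
      z * (a + e) + k   ≡⟨ solve (z ∷ a ∷ e ∷ k ∷ []) ⟩
      z * e + k + z * a ∎)

-- The difference of the two sides is (e − 1)(a² − e).
[a+e]²≤e[a+1]² : ∀ a e → 0 < e → e ≤ a * a → (a + e) * (a + e) ≤ e * ((a + 1) * (a + 1))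
[a+e]²≤e[a+1]² a e@(suc f) _ e≤a² = +-cancelʳ-≤ (f * e) _ _ (begin
  (a + e) * (a + e) + f * e       ≤⟨ +-monoʳ-≤ ((a + e) * (a + e)) (*-monoʳ-≤ f e≤a²) ⟩
  (a + e) * (a + e) + f * (a * a) ≡⟨ solve (a ∷ f ∷ []) ⟩
  e * ((a + 1) * (a + 1)) + f * e ∎)
  where open ≤-Reasoning

ze<[a+e]²⇒z≤a²+2a : ∀ a e z → 0 < e → e ≤ a * a → z * e < (a + e) * (a + e) →
  z ≤ a ^ 2 + 2 * a
ze<[a+e]²⇒z≤a²+2a a e z 0<e e≤a² ze<[a+e]² = ≤-pred (begin-strict
  z                         <⟨ *-cancelˡ-< e _ _ ez<e[a+1]² ⟩
  (a + 1) * (a + 1)         ≡⟨ solve (a ∷ []) ⟩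
  1 + (a * (a * 1) + 2 * a) ≡⟨⟩
  1 + (a ^ 2 + 2 * a)       ∎)
  where
    open ≤-Reasoning
    ez<e[a+1]² : e * z < e * ((a + 1) * (a + 1))
    ez<e[a+1]² = begin-strict
      e * z                   ≡⟨ *-comm e z ⟩
      z * e                   <⟨ ze<[a+e]² ⟩
      (a + e) * (a + e)       ≤⟨ [a+e]²≤e[a+1]² a e 0<e e≤a² ⟩
      e * ((a + 1) * (a + 1)) ∎

square-identity⇒cube⊎small : ∀ a s k z .{{_ : NonZero s}} .{{_ : NonZero k}} → s * k < a + a →
  s * s + z * a ≡ z * (s * k) + k → IsPerfectCube a ⊎ z ≤ a ^ 2 + 2 * a
square-identity⇒cube⊎small a s k z sk<2a eq with <-cmp (s * k) a
... | tri≈ _ sk≡a _ = inj₁ (square-identity-at-a⇒cube a s k z sk≡a eq)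
... | tri< sk<a _ _ = inj₂ (begin
  z             ≤⟨ square-identity-below-a⇒z≤k a s k z sk<a eq ⟩
  k             ≤⟨ m≤n*m k s ⟩
  s * k         <⟨ sk<a ⟩
  a             ≤⟨ m≤m+n a (a + 0) ⟩
  2 * a         ≤⟨ m≤n+m (2 * a) (a ^ 2) ⟩
  a ^ 2 + 2 * a ∎)
  where open ≤-Reasoning
... | tri> _ _ a<sk with m≤n⇒∃[o]m+o≡n a<sk
...   | o , a+1+o≡sk = inj₂ (ze<[a+e]²⇒z≤a²+2a a e z 0<1+n e≤a²
                              (square-identity-above-a⇒ze<[a+e]² a e s k z sk≡a+e eq))
  where
    e : ℕ
    e = suc o
    sk≡a+e : s * k ≡ a + e
    sk≡a+e = trans (sym a+1+o≡sk) (sym (+-suc a o))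
    e<a : e < a
    e<a = +-cancelˡ-< a e a (subst (_< a + a) sk≡a+e sk<2a)
    e≤a² : e ≤ a * a
    e≤a² = ≤-trans (<⇒≤ e<a) (m≤m*n a a {{>-nonZero (≤-trans 0<1+n e<a)}})

ordered-system⇒cube⊎small : ∀ a s b k z → 0 < s → s ≤ b → s + b ≡ k * z → k + s * b ≡ a * z →
  IsPerfectCube a ⊎ z ≤ a ^ 2 + 2 * a
ordered-system⇒cube⊎small a (suc _) b zero z _ _ () _
ordered-system⇒cube⊎small a s@(suc _) b k@(suc _) z _ s≤b s+b≡kz k+sb≡az =
  square-identity⇒cube⊎small a s k z
    (system⇒sk<2a a s b k z s≤b s+b≡kz k+sb≡az)
    (system⇒square-identity a s b k z s+b≡kz k+sb≡az)

system⇒cube⊎small : ∀ a x y k z → 0 < x → 0 < y → x + y ≡ k * z → k + x * y ≡ a * z →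
  IsPerfectCube a ⊎ z ≤ a ^ 2 + 2 * a
system⇒cube⊎small a x y k z 0<x 0<y x+y≡kz k+xy≡az with ≤-total x y
... | inj₁ x≤y = ordered-system⇒cube⊎small a x y k z 0<x x≤y x+y≡kz k+xy≡az
... | inj₂ y≤x = ordered-system⇒cube⊎small a y x k z 0<y y≤x
                   (trans (+-comm y x) x+y≡kz) (trans (cong (k +_) (*-comm y x)) k+xy≡az)

lemma4p2 : (a : ℕ) → 0 < a → ¬ IsPerfectCube a →
           (x y z : ℕ) → 0 < x → 0 < y → 0 < z → z > a ^ 2 + 2 * a →
           ¬ ((x * z + 1) * (y * z + 1) ≡ a * z ^ 3 + 1)
lemma4p2 a _ a-not-cube x y z 0<x 0<y 0<z z>a²+2a eq =
  let k , x+y≡kz , k+xy≡az = reduced⇒system a x y z (cube-equation⇒reduced a x y z eq)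
  in [ a-not-cube , <⇒≱ z>a²+2a ] (system⇒cube⊎small a x y k z 0<x 0<y x+y≡kz k+xy≡az)
  where
    instance
      z≢0 : NonZero z
      z≢0 = >-nonZero 0<z
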